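{- Let $L$ be a modal logic and let $\mathcal{C}$ be a class of Kripke models such that $L$ is sound and complete with respect to $\mathcal{C}$ (i.e. $L\vdash\varphi$ iff $\varphi$ is true at every world of every model in $\mathcal{C}$). If $\mathcal{C}$ enjoys $n$-IP for some natural number $n$, then $L$ has the uniform Lyndon interpolation property (ULIP).
   Context: Modal formulas are built from propositional variables, $\bot$, $\land,\lor,\neg,\to$ and $\Box$ ($\Diamond\varphi:=\neg\Box\neg\varphi$). Positive/negative variables: $v^+(p)=\{p\}$, $v^-(p)=\emptyset$; $v^\circ(\bot)=\emptyset$; $v^\circ(\varphi\ast\psi)=v^\circ(\varphi)\cup v^\circ(\psi)$ for $\ast\in\{\land,\lor\}$; $v^+(\neg\varphi)=v^-(\varphi)$, $v^-(\neg\varphi)=v^+(\varphi)$; $v^+(\varphi\to\psi)=v^-(\varphi)\cup v^+(\psi)$, $v^-(\varphi\to\psi)=v^+(\varphi)\cup v^-(\psi)$; $v^\circ(\Box\varphi)=v^\circ(\varphi)$. The modal depth $d(\varphi)$ is the maximal nesting of $\Box$. A Kripke frame is $(W,R)$ with $W\neq\emptyset$ and $R$ reflexive and transitive; a Kripke model $(W,R,\Vdash)$ adds a valuation with the usual clauses, $\Box\varphi$ true at $x$ iff $\varphi$ true at all $y$ with $xRy$. For finite sets $P^+,P^-$ of variables, a $(P^+,P^-)$-formula is one with $v^\circ(\varphi)\subseteq P^\circ$ for $\circ\in\{+,-\}$. For models $M_0,M_1$ and worlds $w_0,w_1$, write $(M_0,w_0)\xrightarrow[n]{(P^+,P^-)}(M_1,w_1)$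 iff every $(P^+,P^-)$-formula $\varphi$ with $d(\varphi)\le n$ true at $(M_0,w_0)$ is true at $(M_1,w_1)$. A map $f:W\to W'$ between frames is a p-morphism iff $xRy$ implies $f(x)R'f(y)$, and $f(x)R'w$ implies there is $z$ with $xRz$ and $f(z)=w$. A class $\mathcal{C}$ of Kripke models enjoys $n$-IP iff for all finite $P^+,P^-$, all $M_0=(W_0,R_0,\Vdash_0)$, $M_1=(W_1,R_1,\Vdash_1)$ in $\mathcal{C}$ and $w_0\in W_0$, $w_1\in W_1$ with $(M_0,w_0)\xrightarrow[n]{(P^+,P^-)}(M_1,w_1)$, there exist a Kripke frame $(W^*,R^*)$, $w^*\in W^*$, and p-morphisms $f_0:W^*\to W_0$, $f_1:W^*\to W_1$ such that: all Kripke models based on $(W^*,R^*)$ are in $\mathcal{C}$; $f_0(w^*)=w_0$, $f_1(w^*)=w_1$; and for every $x^*\in W^*$, $(M_0,f_0(x^*))\xrightarrow[0]{(P^+,P^-)}(M_1,f_1(x^*))$. A logic $L$ has ULIP iff for every formula $\varphi$ and finite sets $P^+,P^-$ there is $\theta$ with $L\vdash\varphi\to\theta$, $v^\circ(\theta)\subseteq v^\circ(\varphi)\setminus P^\circ$ for $\circ\in\{+,-\}$, and $L\vdash\theta\to\psi$ for every $\psi$ with $L\vdash\varphi\to\psi$ and $v^\circ(\psi)\cap P^\circ=\emptyset$ for $\circ\in\{+,-\}$. -}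

module Defs where

open import Level using (Level; 0ℓ) renaming (suc to lsuc)
open import Data.Nat using (ℕ; zero; suc; _≤_; _⊔_)
open import Data.List using (List; []; _∷_; _++_)
open import Data.List.Membership.Propositional using (_∈_; _∉_)
open import Data.Product using (Σ; _×_; _,_)
open import Data.Sum using (_⊎_)
open import Data.Empty using (⊥)
open import Relation.Binary.PropositionalEquality using (_≡_)

Var : Set
Var = ℕ

infixr 6 _∧'_
infixr 5 _∨'_
infixr 4 _⇒_
data Fm : Set where
  var  : Var → Fm
  ⊥'   : Fm
  _∧'_ : Fm → Fm → Fm
  _∨'_ : Fm → Fm → Fm
  ¬'_  : Fm → Fm
  _⇒_  : Fm → Fm → Fm
  □_   : Fm → Fm

◇_ : Fm → Fm
◇ φ = ¬' (□ (¬' φ))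

v⁺ v⁻ : Fm → List Var
v⁺ (var p)   = p ∷ []
v⁺ ⊥'        = []
v⁺ (φ ∧' ψ)  = v⁺ φ ++ v⁺ ψ
v⁺ (φ ∨' ψ)  = v⁺ φ ++ v⁺ ψ
v⁺ (¬' φ)    = v⁻ φ
v⁺ (φ ⇒ ψ)   = v⁻ φ ++ v⁺ ψ
v⁺ (□ φ)     = v⁺ φ
v⁻ (var p)   = []
v⁻ ⊥'        = []
v⁻ (φ ∧' ψ)  = v⁻ φ ++ v⁻ ψ
v⁻ (φ ∨' ψ)  = v⁻ φ ++ v⁻ ψ
v⁻ (¬' φ)    = v⁺ φ
v⁻ (φ ⇒ ψ)   = v⁺ φ ++ v⁻ ψ
v⁻ (□ φ)     = v⁻ φ

depth : Fm → ℕ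
depth (var p)  = 0
depth ⊥'       = 0
depth (φ ∧' ψ) = depth φ ⊔ depth ψ
depth (φ ∨' ψ) = depth φ ⊔ depth ψ
depth (¬' φ)   = depth φ
depth (φ ⇒ ψ)  = depth φ ⊔ depth ψ
depth (□ φ)    = suc (depth φ)

_⊆_ : List Var → List Var → Set
A ⊆ B = ∀ p → p ∈ A → p ∈ B

_⊆_∖_ : List Var → List Var → List Var → Set
A ⊆ B ∖ C = ∀ p → p ∈ A → (p ∈ B × p ∉ C)

Disjoint : List Var → List Var → Set
Disjoint A B = ∀ p → p ∈ A → p ∉ B

IsPFormula : List Var → List Var → Fm → Set
IsPFormula P⁺ P⁻ φ = (v⁺ φ ⊆ P⁺) × (v⁻ φ ⊆ P⁻)

record Frame : Set₁ where
  field
    W     : Set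
    R     : W → W → Set
    inhab : W
    refl  : ∀ x → R x x
    trans : ∀ x y z → R x y → R y z → R x z

record Model : Set₁ where
  field
    frame : Frame
  open Frame frame public
  field
    val : Var → W → Set

modelOn : (F : Frame) → (Var → Frame.W F → Set) → Model
modelOn F V = record { frame = F ; val = V }

_,_⊩_ : (M : Model) → Model.W M → Fm → Set
M , x ⊩ var p    = Model.val M p x
M , x ⊩ ⊥'       = ⊥
M , x ⊩ (φ ∧' ψ) = (M , x ⊩ φ) × (M , x ⊩ ψ)
M , x ⊩ (φ ∨' ψ) = (M , x ⊩ φ) ⊎ (M , x ⊩ ψ)
M , x ⊩ (¬' φ)   = (M , x ⊩ φ) → ⊥
M , x ⊩ (φ ⇒ ψ)  = (M , x ⊩ φ) → (M , x ⊩ ψ)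
M , x ⊩ (□ φ)    = ∀ y → Model.R M x y → M , y ⊩ φ

ModelClass : Set₂
ModelClass = Model → Set₁

Preserves : List Var → List Var → ℕ →
            (M₀ : Model) → Model.W M₀ → (M₁ : Model) → Model.W M₁ → Set
Preserves P⁺ P⁻ n M₀ w₀ M₁ w₁ =
  ∀ φ → IsPFormula P⁺ P⁻ φ → depth φ ≤ n → M₀ , w₀ ⊩ φ → M₁ , w₁ ⊩ φ

IsPMorphism : (F G : Frame) → (Frame.W F → Frame.W G) → Set
IsPMorphism F G f =
  (∀ x y → Frame.R F x y → Frame.R G (f x) (f y)) ×
  (∀ x w → Frame.R G (f x) w → Σ (Frame.W F) λ z → Frame.R F x z × f z ≡ w)

HasNIP : ModelClass → ℕ → Set₁
HasNIP 𝒞 n =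
  ∀ (P⁺ P⁻ : List Var) (M₀ M₁ : Model) → 𝒞 M₀ → 𝒞 M₁ →
  (w₀ : Model.W M₀) (w₁ : Model.W M₁) →
  Preserves P⁺ P⁻ n M₀ w₀ M₁ w₁ →
  Σ Frame λ F* → Σ (Frame.W F*) λ w* →
  Σ (Frame.W F* → Model.W M₀) λ f₀ →
  Σ (Frame.W F* → Model.W M₁) λ f₁ →
    IsPMorphism F* (Model.frame M₀) f₀ ×
    IsPMorphism F* (Model.frame M₁) f₁ ×
    (∀ (V : Var → Frame.W F* → Set) → 𝒞 (modelOn F* V)) ×
    f₀ w* ≡ w₀ × f₁ w* ≡ w₁ ×
    (∀ x* → Preserves P⁺ P⁻ 0 M₀ (f₀ x*) M₁ (f₁ x*))

Logic : Set₁
Logic = Fm → Set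

ValidIn : ModelClass → Fm → Set₁
ValidIn 𝒞 φ = ∀ (M : Model) → 𝒞 M → ∀ (w : Model.W M) → M , w ⊩ φ

SoundComplete : Logic → ModelClass → Set₁
SoundComplete L 𝒞 = ∀ φ → (L φ → ValidIn 𝒞 φ) × (ValidIn 𝒞 φ → L φ)

ULIP : Logic → Set
ULIP L =
  ∀ (φ : Fm) (P⁺ P⁻ : List Var) → Σ Fm λ θ →
    L (φ ⇒ θ) ×
    (v⁺ θ ⊆ v⁺ φ ∖ P⁺) × (v⁻ θ ⊆ v⁻ φ ∖ P⁻) ×
    (∀ ψ → L (φ ⇒ ψ) → Disjoint (v⁺ ψ) P⁺ → Disjoint (v⁻ ψ) P⁻ → L (θ ⇒ ψ))

{-# OPTIONS --safe #-}
-- Let Q⁺, Q⁻ be the positive and negative variables of φ outside P⁺, P⁻. Agreement of two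
-- pointed models on the finite list Γ n of characteristic (Q⁺,Q⁻)-formulas of depth n is a
-- depth-n back-and-forth, hence yields agreement on all (Q⁺,Q⁻)-formulas of depth ≤ n. The
-- interpolant θ is the conjunction of those disjunctions of subsets of Γ n that L derives
-- from φ. If θ held at w₁ while an admissible consequence ψ of φ failed, the disjunction of
-- the members of Γ n refuted at w₁ would be among them, so every φ-world w₀ agrees into w₁.
-- n-IP then provides a common p-morphic preimage of (M₀,w₀) and (M₁,w₁); valuing the positive
-- variables of φ as in M₀ and the negative ones of ψ as in M₁, φ pulls back to it, so ψ
-- holds there and pushes forward to w₁.

module Submission where

open import Defs
open import Level using (0ℓ) renaming (suc to lsuc)
open import Data.Nat using (ℕ; zero; suc; _≤_; s≤s; z≤n; _≟_)
open import Data.Nat.Properties using (≤-refl; m⊔n≤o⇒m≤o; m⊔n≤o⇒n≤o)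
open import Axiom.ExcludedMiddle using (ExcludedMiddle)
open import Axiom.DoubleNegationElimination using (em⇒dne)
open import Data.List using (List; []; _∷_; _++_; map; filter)
open import Data.List.Membership.Propositional using (_∈_)
open import Data.List.Membership.Propositional.Properties
  using (∈-++⁺ˡ; ∈-++⁺ʳ; ∈-++⁻; ∈-map⁺; ∈-map⁻; ∈-filter⁺; ∈-filter⁻)
open import Data.List.Membership.DecPropositional _≟_ using (_∉?_)
open import Data.List.Relation.Unary.Any using (here; there)
open import Data.List.Relation.Binary.Sublist.Propositional
  using ([]; _∷_; _∷ʳ_; lookup) renaming (_⊆_ to _⊑_)
open import Data.List.Relation.Binary.Sublist.Propositional.Properties using (filter-⊆)
open import Data.Product using (Σ; _×_; _,_; proj₁; proj₂)
open import Data.Sum using (_⊎_; inj₁; inj₂; [_,_]′)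
open import Relation.Nullary using (¬_)
open import Relation.Unary using (Decidable)
open import Relation.Binary.PropositionalEquality using (_≡_; refl)
open import Function using (_∘_)

⊤' : Fm
⊤' = ⊥' ⇒ ⊥'

⋀ ⋁ : List Fm → Fm
⋀ []      = ⊤'
⋀ (γ ∷ Δ) = γ ∧' ⋀ Δ
⋁ []      = ⊥'
⋁ (γ ∷ Δ) = γ ∨' ⋁ Δ

module _ {M : Model} {x : Model.W M} where

  ⊩-⋀⁺ : ∀ {Δ} → (∀ {γ} → γ ∈ Δ → M , x ⊩ γ) → M , x ⊩ ⋀ Δ
  ⊩-⋀⁺ {[]}    h = λ ()
  ⊩-⋀⁺ {γ ∷ Δ} h = h (here refl) , ⊩-⋀⁺ (h ∘ there)

  ⊩-⋀⁻ : ∀ {Δ γ} → M , x ⊩ ⋀ Δ → γ ∈ Δ → M , x ⊩ γ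
  ⊩-⋀⁻ {_ ∷ _} (h , _) (here refl) = h
  ⊩-⋀⁻ {_ ∷ _} (_ , h) (there γ∈Δ) = ⊩-⋀⁻ h γ∈Δ

  ⊩-⋁⁺ : ∀ {Δ γ} → γ ∈ Δ → M , x ⊩ γ → M , x ⊩ ⋁ Δ
  ⊩-⋁⁺ (here refl)  h = inj₁ h
  ⊩-⋁⁺ (there γ∈Δ) h = inj₂ (⊩-⋁⁺ γ∈Δ h)

  ⊮-⋁ : ∀ {Δ} → (∀ {γ} → γ ∈ Δ → ¬ (M , x ⊩ γ)) → ¬ (M , x ⊩ ⋁ Δ)
  ⊮-⋁ {γ ∷ Δ} h (inj₁ hγ) = h (here refl) hγ
  ⊮-⋁ {γ ∷ Δ} h (inj₂ hΔ) = ⊮-⋁ (h ∘ there) hΔ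

++-⊆ : ∀ {A B C} → A ⊆ C → B ⊆ C → (A ++ B) ⊆ C
++-⊆ {A} A⊆C B⊆C p p∈ = [ A⊆C p , B⊆C p ]′ (∈-++⁻ A p∈)

module _ {P⁺ P⁻ : List Var} where

  var-IsPFormula : ∀ {p} → p ∈ P⁺ → IsPFormula P⁺ P⁻ (var p)
  var-IsPFormula p∈ = (λ { _ (here refl) → p∈ }) , (λ _ ())

  ¬var-IsPFormula : ∀ {p} → p ∈ P⁻ → IsPFormula P⁺ P⁻ (¬' var p)
  ¬var-IsPFormula p∈ = (λ _ ()) , (λ { _ (here refl) → p∈ })

  IsPFormula-⋀ : ∀ Δ → (∀ {γ} → γ ∈ Δ → IsPFormula P⁺ P⁻ γ) → IsPFormula P⁺ P⁻ (⋀ Δ)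
  IsPFormula-⋀ []      _ = (λ _ ()) , (λ _ ())
  IsPFormula-⋀ (γ ∷ Δ) h =
    let (γ⁺ , γ⁻) = h (here refl); (Δ⁺ , Δ⁻) = IsPFormula-⋀ Δ (h ∘ there)
    in ++-⊆ {v⁺ γ} γ⁺ Δ⁺ , ++-⊆ {v⁻ γ} γ⁻ Δ⁻

  IsPFormula-⋁ : ∀ Δ → (∀ {γ} → γ ∈ Δ → IsPFormula P⁺ P⁻ γ) → IsPFormula P⁺ P⁻ (⋁ Δ)
  IsPFormula-⋁ []      _ = (λ _ ()) , (λ _ ())
  IsPFormula-⋁ (γ ∷ Δ) h =
    let (γ⁺ , γ⁻) = h (here refl); (Δ⁺ , Δ⁻) = IsPFormula-⋁ Δ (h ∘ there)
    in ++-⊆ {v⁺ γ} γ⁺ Δ⁺ , ++-⊆ {v⁻ γ} γ⁻ Δ⁻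

sublists : ∀ {A : Set} → List A → List (List A)
sublists []       = [] ∷ []
sublists (x ∷ xs) = map (x ∷_) (sublists xs) ++ sublists xs

∈-sublists⁺ : ∀ {A : Set} {xs ys : List A} → ys ⊑ xs → ys ∈ sublists xs
∈-sublists⁺ []         = here refl
∈-sublists⁺ (x ∷ʳ τ)   = ∈-++⁺ʳ _ (∈-sublists⁺ τ)
∈-sublists⁺ (refl ∷ τ) = ∈-++⁺ˡ (∈-map⁺ _ (∈-sublists⁺ τ))

∈-sublists⁻ : ∀ {A : Set} xs {ys : List A} → ys ∈ sublists xs → ys ⊑ xs
∈-sublists⁻ [] (here refl) = []
∈-sublists⁻ (x ∷ xs) ys∈ with ∈-++⁻ (map (x ∷_) (sublists xs)) ys∈
... | inj₂ ys∈′ = x ∷ʳ ∈-sublists⁻ xs ys∈′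
... | inj₁ x∷ys∈ with ∈-map⁻ (x ∷_) x∷ys∈
...   | _ , ys∈′ , refl = refl ∷ ∈-sublists⁻ xs ys∈′

IsPFormula-sublists : ∀ {P⁺ P⁻ Δ} → (∀ {γ} → γ ∈ Δ → IsPFormula P⁺ P⁻ γ) →
                       ∀ {S} → S ∈ sublists Δ → IsPFormula P⁺ P⁻ (⋁ S) × IsPFormula P⁺ P⁻ (⋀ S)
IsPFormula-sublists {Δ = Δ} h {S} S∈ =
  IsPFormula-⋁ S (h ∘ lookup (∈-sublists⁻ Δ S∈)) , IsPFormula-⋀ S (h ∘ lookup (∈-sublists⁻ Δ S∈))

record GradedZigZag (A B : Model) : Set₁ where
  field
    related : ℕ → Model.W A → Model.W B → Set
    forth   : ∀ {k a b a'} → related (suc k) a b → Model.R A a a' →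
              Σ (Model.W B) λ b' → Model.R B b b' × related k a' b'
    back    : ∀ {k a b b'} → related (suc k) a b → Model.R B b b' →
              Σ (Model.W A) λ a' → Model.R A a a' × related k a' b'

open GradedZigZag

converse : ∀ {A B} → GradedZigZag A B → GradedZigZag B A
converse Z = record { related = λ k b a → related Z k a b ; forth = back Z ; back = forth Z }

graph : ∀ {N M} (f : Model.W N → Model.W M) → IsPMorphism (Model.frame N) (Model.frame M) f →
        GradedZigZag N M
graph f (hom , lift) = record
  { related = λ _ x a → f x ≡ a
  ; forth   = λ { refl xRx' → _ , hom _ _ xRx' , refl }
  ; back    = λ { refl fxRa' → lift _ _ fxRa' }
  }

module _ {A B : Model} (Z : GradedZigZag A B) where

  Transfers : List Var → Set
  Transfers X = ∀ {p} → p ∈ X → ∀ {k a b} → related Z k a b → Model.val A p a → Model.val B p b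

  transfers-⊆ : ∀ {X Y} → X ⊆ Y → Transfers Y → Transfers X
  transfers-⊆ X⊆Y t p∈ = t (X⊆Y _ p∈)

  transfers-++ˡ : ∀ {X Y} → Transfers (X ++ Y) → Transfers X
  transfers-++ˡ = transfers-⊆ (λ _ → ∈-++⁺ˡ)

  transfers-++ʳ : ∀ X {Y} → Transfers (X ++ Y) → Transfers Y
  transfers-++ʳ X = transfers-⊆ (λ _ → ∈-++⁺ʳ X)

-- ¬ and ⇒ swap v⁺ with v⁻ and the direction of transfer, hence the converse relation.
transfer : ∀ {A B} (Z : GradedZigZag A B) χ → Transfers Z (v⁺ χ) → Transfers (converse Z) (v⁻ χ) →
           ∀ {k a b} → depth χ ≤ k → related Z k a b → A , a ⊩ χ → B , b ⊩ χ
transfer Z (var p) t⁺ _ _ r h = t⁺ (here refl) r h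
transfer Z ⊥' _ _ _ _ ()
transfer Z (χ ∧' ξ) t⁺ t⁻ d r (hχ , hξ) =
    transfer Z χ (transfers-++ˡ Z t⁺) (transfers-++ˡ (converse Z) t⁻) (m⊔n≤o⇒m≤o _ _ d) r hχ
  , transfer Z ξ (transfers-++ʳ Z (v⁺ χ) t⁺) (transfers-++ʳ (converse Z) (v⁻ χ) t⁻)
               (m⊔n≤o⇒n≤o _ _ d) r hξ
transfer Z (χ ∨' ξ) t⁺ t⁻ d r (inj₁ hχ) =
  inj₁ (transfer Z χ (transfers-++ˡ Z t⁺) (transfers-++ˡ (converse Z) t⁻) (m⊔n≤o⇒m≤o _ _ d) r hχ)
transfer Z (χ ∨' ξ) t⁺ t⁻ d r (inj₂ hξ) =
  inj₂ (transfer Z ξ (transfers-++ʳ Z (v⁺ χ) t⁺) (transfers-++ʳ (converse Z) (v⁻ χ) t⁻)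
                     (m⊔n≤o⇒n≤o _ _ d) r hξ)
transfer Z (¬' χ) t⁺ t⁻ d r h = h ∘ transfer (converse Z) χ t⁻ t⁺ d r
transfer Z (χ ⇒ ξ) t⁺ t⁻ d r h =
    transfer Z ξ (transfers-++ʳ Z (v⁻ χ) t⁺) (transfers-++ʳ (converse Z) (v⁺ χ) t⁻)
                 (m⊔n≤o⇒n≤o _ _ d) r
  ∘ h
  ∘ transfer (converse Z) χ (transfers-++ˡ (converse Z) t⁻) (transfers-++ˡ Z t⁺)
                            (m⊔n≤o⇒m≤o _ _ d) r
transfer Z (□ χ) t⁺ t⁻ (s≤s d) r h b' bRb' =
  let a' , aRa' , r' = back Z r bRb' in transfer Z χ t⁺ t⁻ d r' (h a' aRa')

Agree : List Fm → (A : Model) → Model.W A → (B : Model) → Model.W B → Set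
Agree Δ A a B b = ∀ γ → γ ∈ Δ → A , a ⊩ γ → B , b ⊩ γ

modalOver : List Fm → List Fm
modalOver Δ = map (□_ ∘ ⋁) (sublists Δ) ++ map (◇_ ∘ ⋀) (sublists Δ)

module _ (em : ExcludedMiddle 0ℓ) where

  private
    dne : {P : Set} → ¬ ¬ P → P
    dne = em⇒dne em

  holds? : (M : Model) (x : Model.W M) → Decidable (M , x ⊩_)
  holds? _ _ _ = em

  fails? : (M : Model) (x : Model.W M) → Decidable (λ γ → ¬ (M , x ⊩ γ))
  fails? _ _ _ = em

  verified refuted : List Fm → (M : Model) → Model.W M → List Fm
  verified Δ M x = filter (holds? M x) Δ
  refuted  Δ M x = filter (fails? M x) Δ

  module _ {Δ : List Fm} {A : Model} {a : Model.W A} where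

    ⊩-⋀-verified : A , a ⊩ ⋀ (verified Δ A a)
    ⊩-⋀-verified = ⊩-⋀⁺ {A} {a} {verified Δ A a} λ γ∈ → proj₂ (∈-filter⁻ (holds? A a) {xs = Δ} γ∈)

    ⊩-⋀-verified⇒Agree : ∀ {B b} → B , b ⊩ ⋀ (verified Δ A a) → Agree Δ A a B b
    ⊩-⋀-verified⇒Agree h _ γ∈Δ hγ = ⊩-⋀⁻ h (∈-filter⁺ (holds? A a) γ∈Δ hγ)

    ⊮-⋁-refuted : ¬ (A , a ⊩ ⋁ (refuted Δ A a))
    ⊮-⋁-refuted = ⊮-⋁ {A} {a} {refuted Δ A a} λ γ∈ → proj₂ (∈-filter⁻ (fails? A a) {xs = Δ} γ∈)

    ⊮-⋁-refuted⇒Agree : ∀ {B b} → ¬ (B , b ⊩ ⋁ (refuted Δ A a)) → Agree Δ B b A a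
    ⊮-⋁-refuted⇒Agree ¬h _ γ∈Δ hγ = dne λ ¬hγ → ¬h (⊩-⋁⁺ (∈-filter⁺ (fails? A a) γ∈Δ ¬hγ) hγ)

  module Characteristic (Q⁺ Q⁻ : List Var) where

    literals : List Fm
    literals = map var Q⁺ ++ map (¬'_ ∘ var) Q⁻

    -- ◇ ⋀ (what holds at a') gives the forth and □ ⋁ (what fails at b') the back
    -- condition for agreement on Γ.
    Γ : ℕ → List Fm
    Γ zero    = literals
    Γ (suc k) = literals ++ modalOver (Γ k)

    literal∈Γ : ∀ k {γ} → γ ∈ literals → γ ∈ Γ k
    literal∈Γ zero    = λ γ∈ → γ∈
    literal∈Γ (suc k) = ∈-++⁺ˡ

    var∈Γ : ∀ k {p} → p ∈ Q⁺ → var p ∈ Γ k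
    var∈Γ k p∈ = literal∈Γ k (∈-++⁺ˡ {ys = map (¬'_ ∘ var) Q⁻} (∈-map⁺ var p∈))

    ¬var∈Γ : ∀ k {p} → p ∈ Q⁻ → ¬' var p ∈ Γ k
    ¬var∈Γ k p∈ = literal∈Γ k (∈-++⁺ʳ (map var Q⁺) (∈-map⁺ (¬'_ ∘ var) p∈))

    □⋁∈Γ : ∀ k {S} → S ⊑ Γ k → □ ⋁ S ∈ Γ (suc k)
    □⋁∈Γ _ S⊑ = ∈-++⁺ʳ literals (∈-++⁺ˡ (∈-map⁺ (□_ ∘ ⋁) (∈-sublists⁺ S⊑)))

    ◇⋀∈Γ : ∀ k {S} → S ⊑ Γ k → ◇ ⋀ S ∈ Γ (suc k)
    ◇⋀∈Γ k S⊑ =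
      ∈-++⁺ʳ literals (∈-++⁺ʳ (map (□_ ∘ ⋁) (sublists (Γ k))) (∈-map⁺ (◇_ ∘ ⋀) (∈-sublists⁺ S⊑)))

    literals-IsPFormula : ∀ {γ} → γ ∈ literals → IsPFormula Q⁺ Q⁻ γ
    literals-IsPFormula γ∈ with ∈-++⁻ (map var Q⁺) γ∈
    ... | inj₁ γ∈⁺ with ∈-map⁻ var γ∈⁺
    ...   | _ , p∈ , refl = var-IsPFormula p∈
    literals-IsPFormula γ∈ | inj₂ γ∈⁻ with ∈-map⁻ (¬'_ ∘ var) γ∈⁻
    ...   | _ , p∈ , refl = ¬var-IsPFormula p∈

    Γ-IsPFormula : ∀ k {γ} → γ ∈ Γ k → IsPFormula Q⁺ Q⁻ γ
    Γ-IsPFormula zero γ∈ = literals-IsPFormula γ∈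
    Γ-IsPFormula (suc k) γ∈ with ∈-++⁻ literals γ∈
    ... | inj₁ γ∈′ = literals-IsPFormula γ∈′
    ... | inj₂ γ∈′ with ∈-++⁻ (map (□_ ∘ ⋁) (sublists (Γ k))) γ∈′
    ...   | inj₁ γ∈□ with ∈-map⁻ (□_ ∘ ⋁) γ∈□
    ...     | _ , S∈ , refl = proj₁ (IsPFormula-sublists (Γ-IsPFormula k) S∈)
    Γ-IsPFormula (suc k) γ∈ | inj₂ γ∈′ | inj₂ γ∈◇ with ∈-map⁻ (◇_ ∘ ⋀) γ∈◇
    ...     | _ , S∈ , refl = proj₂ (IsPFormula-sublists (Γ-IsPFormula k) S∈)

    module _ {A B : Model} where

      Agree-forth : ∀ {k a b a'} → Agree (Γ (suc k)) A a B b → Model.R A a a' →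
                    Σ (Model.W B) λ b' → Model.R B b b' × Agree (Γ k) A a' B b'
      Agree-forth {k} {a' = a'} ag aRa' = dne λ ¬match →
        ag _ (◇⋀∈Γ k (filter-⊆ (holds? A a') (Γ k)))
           (λ ⊩□¬ → ⊩□¬ a' aRa' (⊩-⋀-verified {Γ k}))
           (λ b' bRb' h → ¬match (b' , bRb' , ⊩-⋀-verified⇒Agree h))

      Agree-back : ∀ {k a b b'} → Agree (Γ (suc k)) A a B b → Model.R B b b' →
                   Σ (Model.W A) λ a' → Model.R A a a' × Agree (Γ k) A a' B b'
      Agree-back {k} {b' = b'} ag bRb' = dne λ ¬match →
        ⊮-⋁-refuted {Γ k} (ag _ (□⋁∈Γ k (filter-⊆ (fails? B b') (Γ k)))
                        (λ a' aRa' → dne λ ¬h → ¬match (a' , aRa' , ⊮-⋁-refuted⇒Agree ¬h))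
                        b' bRb')

      agreement : GradedZigZag A B
      agreement = record
        { related = λ k a b → Agree (Γ k) A a B b
        ; forth   = λ {k} → Agree-forth {k}
        ; back    = λ {k} → Agree-back {k}
        }

      agreement-transfers⁺ : Transfers agreement Q⁺
      agreement-transfers⁺ {p} p∈ {k} ag = ag (var p) (var∈Γ k p∈)

      agreement-transfers⁻ : Transfers (converse agreement) Q⁻
      agreement-transfers⁻ {p} p∈ {k} ag hb = dne λ ¬ha → ag (¬' var p) (¬var∈Γ k p∈) ¬ha hb

      Agree⇒Preserves : ∀ {k a b} → Agree (Γ k) A a B b → Preserves Q⁺ Q⁻ k A a B b
      Agree⇒Preserves ag χ (v⁺⊆ , v⁻⊆) d =
        transfer agreement χ (transfers-⊆ agreement v⁺⊆ agreement-transfers⁺)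
                             (transfers-⊆ (converse agreement) v⁻⊆ agreement-transfers⁻) d ag

  HasNIP⇒consequence-transfer :
    ∀ {𝒞 n φ ψ Q⁺ Q⁻} → HasNIP 𝒞 n → ValidIn 𝒞 (φ ⇒ ψ) →
    (∀ {p} → p ∈ v⁺ φ → p ∈ v⁺ ψ → p ∈ Q⁺) → (∀ {p} → p ∈ v⁻ φ → p ∈ v⁻ ψ → p ∈ Q⁻) →
    ∀ {M₀ M₁ w₀ w₁} → 𝒞 M₀ → 𝒞 M₁ → Preserves Q⁺ Q⁻ n M₀ w₀ M₁ w₁ → M₀ , w₀ ⊩ φ → M₁ , w₁ ⊩ ψ
  HasNIP⇒consequence-transfer {φ = φ} {ψ} {Q⁺} {Q⁻} nip ⊨φ⇒ψ shared⁺ shared⁻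
                              {M₀} {M₁} {w₀} {w₁} c₀ c₁ pres h
    with nip Q⁺ Q⁻ M₀ M₁ c₀ c₁ w₀ w₁ pres
  ... | F* , w* , f₀ , f₁ , pm₀ , pm₁ , F*⊆𝒞 , f₀w*≡w₀ , f₁w*≡w₁ , literals-agree =
    transfer Z₁ ψ up₁ down₁ ≤-refl f₁w*≡w₁
      (⊨φ⇒ψ N (F*⊆𝒞 V) w* (transfer (converse Z₀) φ up₀ down₀ ≤-refl f₀w*≡w₀ h))
    where
    -- Where φ and ψ share a variable with matching polarity, f₀ x and f₁ x agree on the
    -- literal, so f₀ and f₁ still respect V in the direction each transfer needs.
    V : Var → Frame.W F* → Set
    V p x = (p ∈ v⁺ φ × Model.val M₀ p (f₀ x)) ⊎ (p ∈ v⁻ ψ × Model.val M₁ p (f₁ x))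

    N : Model
    N = modelOn F* V

    Z₀ : GradedZigZag N M₀
    Z₀ = graph f₀ pm₀

    Z₁ : GradedZigZag N M₁
    Z₁ = graph f₁ pm₁

    up₀ : Transfers (converse Z₀) (v⁺ φ)
    up₀ p∈ refl h₀ = inj₁ (p∈ , h₀)

    down₀ : Transfers Z₀ (v⁻ φ)
    down₀ _ refl (inj₁ (_ , h₀)) = h₀
    down₀ {p} p∈φ {a = x} refl (inj₂ (p∈ψ , h₁)) = dne λ ¬h₀ →
      literals-agree x (¬' var p) (¬var-IsPFormula (shared⁻ p∈φ p∈ψ)) z≤n ¬h₀ h₁

    up₁ : Transfers Z₁ (v⁺ ψ)
    up₁ {p} p∈ψ {a = x} refl (inj₁ (p∈φ , h₀)) =
      literals-agree x (var p) (var-IsPFormula (shared⁺ p∈φ p∈ψ)) z≤n h₀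
    up₁ _ refl (inj₂ (_ , h₁)) = h₁

    down₁ : Transfers (converse Z₁) (v⁻ ψ)
    down₁ p∈ refl h₁ = inj₂ (p∈ , h₁)

  module UniformInterpolant (L : Logic) (𝒞 : ModelClass) (sc : SoundComplete L 𝒞)
                            (n : ℕ) (nip : HasNIP 𝒞 n) (φ : Fm) (P⁺ P⁻ : List Var) where

    sound : ∀ {χ} → L χ → ValidIn 𝒞 χ
    sound = proj₁ (sc _)

    complete : ∀ {χ} → ValidIn 𝒞 χ → L χ
    complete = proj₂ (sc _)

    Q⁺ Q⁻ : List Var
    Q⁺ = filter (_∉? P⁺) (v⁺ φ)
    Q⁻ = filter (_∉? P⁻) (v⁻ φ)

    open Characteristic Q⁺ Q⁻

    entailed? : Decidable (λ δ → L (φ ⇒ δ))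
    entailed? _ = em

    conjuncts : List Fm
    conjuncts = filter entailed? (map ⋁ (sublists (Γ n)))

    θ : Fm
    θ = ⋀ conjuncts

    ∈-conjuncts : ∀ {S} → S ⊑ Γ n → L (φ ⇒ ⋁ S) → ⋁ S ∈ conjuncts
    ∈-conjuncts S⊑ = ∈-filter⁺ entailed? (∈-map⁺ ⋁ (∈-sublists⁺ S⊑))

    conjunct-entailed : ∀ {δ} → δ ∈ conjuncts → L (φ ⇒ δ)
    conjunct-entailed δ∈ = proj₂ (∈-filter⁻ entailed? {xs = map ⋁ (sublists (Γ n))} δ∈)

    conjunct-IsPFormula : ∀ {δ} → δ ∈ conjuncts → IsPFormula Q⁺ Q⁻ δ
    conjunct-IsPFormula δ∈ with ∈-map⁻ ⋁ (proj₁ (∈-filter⁻ entailed? δ∈))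
    ... | _ , S∈ , refl = proj₁ (IsPFormula-sublists (Γ-IsPFormula n) S∈)

    φ⇒θ : L (φ ⇒ θ)
    φ⇒θ = complete λ M c w h → ⊩-⋀⁺ {M} {w} {conjuncts} λ δ∈ → sound (conjunct-entailed δ∈) M c w h

    θ-IsPFormula : IsPFormula Q⁺ Q⁻ θ
    θ-IsPFormula = IsPFormula-⋀ conjuncts conjunct-IsPFormula

    θ-vars⁺ : v⁺ θ ⊆ v⁺ φ ∖ P⁺
    θ-vars⁺ p p∈ = ∈-filter⁻ (_∉? P⁺) (proj₁ θ-IsPFormula p p∈)

    θ-vars⁻ : v⁻ θ ⊆ v⁻ φ ∖ P⁻
    θ-vars⁻ p p∈ = ∈-filter⁻ (_∉? P⁻) (proj₂ θ-IsPFormula p p∈)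

    module _ {ψ} (⊢φ⇒ψ : L (φ ⇒ ψ))
             (ψ⁺∉P⁺ : Disjoint (v⁺ ψ) P⁺) (ψ⁻∉P⁻ : Disjoint (v⁻ ψ) P⁻) where

      ⊢φ⇒⋁refuted : ∀ {M₁ w₁} → 𝒞 M₁ → ¬ (M₁ , w₁ ⊩ ψ) → L (φ ⇒ ⋁ (refuted (Γ n) M₁ w₁))
      ⊢φ⇒⋁refuted {M₁} {w₁} c₁ ¬ψ = complete λ M₀ c₀ w₀ h → dne λ ¬⋁ →
        ¬ψ (HasNIP⇒consequence-transfer {φ = φ} {ψ} nip (sound ⊢φ⇒ψ)
              (λ p∈φ p∈ψ → ∈-filter⁺ (_∉? P⁺) p∈φ (ψ⁺∉P⁺ _ p∈ψ))
              (λ p∈φ p∈ψ → ∈-filter⁺ (_∉? P⁻) p∈φ (ψ⁻∉P⁻ _ p∈ψ))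
              {w₀ = w₀} c₀ c₁ (Agree⇒Preserves {k = n} (⊮-⋁-refuted⇒Agree {Γ n} {M₁} {w₁} ¬⋁))
              h)

      θ⇒ψ : L (θ ⇒ ψ)
      θ⇒ψ = complete λ M₁ c₁ w₁ hθ → dne λ ¬ψ →
        let ⋁refuted∈ = ∈-conjuncts (filter-⊆ (fails? M₁ w₁) (Γ n)) (⊢φ⇒⋁refuted c₁ ¬ψ)
        in ⊮-⋁-refuted {Γ n} {M₁} {w₁} (⊩-⋀⁻ {M₁} {w₁} {conjuncts} hθ ⋁refuted∈)

theorem3p7 : ExcludedMiddle 0ℓ → ExcludedMiddle (lsuc 0ℓ) →
             (L : Logic) (𝒞 : ModelClass) → SoundComplete L 𝒞 →
             (n : ℕ) → HasNIP 𝒞 n → ULIP L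
theorem3p7 em _ L 𝒞 sc n nip φ P⁺ P⁻ = θ , φ⇒θ , θ-vars⁺ , θ-vars⁻ , λ ψ → θ⇒ψ {ψ}
  where open UniformInterpolant em L 𝒞 sc n nip φ P⁺ P⁻
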